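{- As formal power series in $y$, \[ \sum_{n\ge 0} D_n^-(x)y^n = \frac{1+xy-x^2y^3-x^2y^4}{1-y-xy^2}. \]
   Context: For $n\ge 0$, the $S$-fence $\phi_n$ is the poset on $\{x_1,\dots,x_n\}$ whose order is generated by the cover relations $x_2<x_1$, $x_3<x_2$, $x_2<x_4$, $x_5<x_4$, and, for every $i\ge 3$, $x_{2i-1}<x_{2i}$ and $x_{2i+1}<x_{2i}$, keeping only those relations whose elements both have index $\le n$ ($\phi_0$ is empty). A filter is an up-set. $\mathcal{F}(\phi_n)$ is the lattice of filters of $\phi_n$ ordered by reverse inclusion ($Y'\le Y$ iff $Y'\supseteq Y$). Its Hasse diagram $\Phi_n$ is viewed as a directed graph with an arc $(X,Y)$ whenever $Y$ is covered by $X$ in $\mathcal{F}(\phi_n)$; so the indegree of a filter $Y$ is the number of elements of $\mathcal{F}(\phi_n)$ covering $Y$, which equals the number of minimal elements of $Y$. $d^-_{n,k}$ is the number of vertices of indegree $k$ and $D_n^-(x)=\sum_{k\ge0}d^-_{n,k}x^k$. -}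

module Defs where

open import Data.Bool using (Bool; true; false; _∧_; _∨_; not; if_then_else_)
open import Data.Nat using (ℕ; zero; suc; _≡ᵇ_; _≤ᵇ_; _+_; _∸_)
open import Data.Nat.Base using (_%_)
open import Data.Fin using (Fin; toℕ; _≟_)
open import Data.Fin.Base using () renaming (zero to fzero; suc to fsuc)
open import Data.Vec using (Vec; []; _∷_; lookup)
open import Data.List using (List; []; _∷_; _++_; map; length; filterᵇ; allFin)
open import Data.Bool.ListAction using (any; all)
open import Data.Integer using (ℤ; +_; -_) renaming (_+_ to _+ℤ_; _*_ to _*ℤ_)
open import Relation.Nullary.Decidable using (⌊_⌋)
open import Relation.Binary.PropositionalEquality using (_≡_)

-- The S-fence φ_n.  Element x_m (1 ≤ m ≤ n) is represented by i : Fin n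
-- with m = toℕ i + 1.

-- gen a b = true  iff  "x_a < x_b" is one of the generating cover relations:
--   x2<x1, x3<x2, x2<x4, x5<x4, and for i ≥ 3: x_{2i-1} < x_{2i}, x_{2i+1} < x_{2i}.
-- (The last family says: b even, b ≥ 6, and a = b-1 or a = b+1.)
gen : ℕ → ℕ → Bool
gen a b =
     ((a ≡ᵇ 2) ∧ (b ≡ᵇ 1))
  ∨ ((a ≡ᵇ 3) ∧ (b ≡ᵇ 2))
  ∨ ((a ≡ᵇ 2) ∧ (b ≡ᵇ 4))
  ∨ ((a ≡ᵇ 5) ∧ (b ≡ᵇ 4))
  ∨ (((b % 2) ≡ᵇ 0) ∧ (6 ≤ᵇ b) ∧ ((a + 1 ≡ᵇ b) ∨ (a ≡ᵇ b + 1)))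

cov : ∀ {n} → Fin n → Fin n → Bool
cov i j = gen (suc (toℕ i)) (suc (toℕ j))

reach : ∀ {n} → ℕ → Fin n → Fin n → Bool
reach zero    i j = false
reach (suc s) i j = cov i j ∨ any (λ k → cov i k ∧ reach s k j) (allFin _)

-- strict order of φ_n: transitive closure of the generating relations
-- (in an n-element poset, chains of length ≤ n suffice)
lt : ∀ {n} → Fin n → Fin n → Bool
lt {n} i j = reach n i j

le : ∀ {n} → Fin n → Fin n → Bool
le i j = ⌊ i ≟ j ⌋ ∨ lt i j

Subset : ℕ → Set
Subset n = Vec Bool n

allSubsets : (n : ℕ) → List (Subset n)
allSubsets zero    = [] ∷ []
allSubsets (suc n) = map (true ∷_) (allSubsets n) ++ map (false ∷_) (allSubsets n)

_∈ᵇ_ : ∀ {n} → Fin n → Subset n → Bool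
i ∈ᵇ Y = lookup Y i

isFilter : ∀ {n} → Subset n → Bool
isFilter {n} Y = all (λ i → all (λ j → not (i ∈ᵇ Y ∧ le i j) ∨ j ∈ᵇ Y) (allFin n)) (allFin n)

filters : (n : ℕ) → List (Subset n)
filters n = filterᵇ isFilter (allSubsets n)

⊆ᵇ : ∀ {n} → Subset n → Subset n → Bool
⊆ᵇ {n} X Y = all (λ i → not (i ∈ᵇ X) ∨ i ∈ᵇ Y) (allFin n)

⊊ᵇ : ∀ {n} → Subset n → Subset n → Bool
⊊ᵇ X Y = ⊆ᵇ X Y ∧ not (⊆ᵇ Y X)

-- In F(φ_n) ordered by reverse inclusion, X covers Y iff X ⊊ Y and no
-- filter Z satisfies X ⊊ Z ⊊ Y.
covers : ∀ {n} → Subset n → Subset n → Bool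
covers {n} X Y = ⊊ᵇ X Y ∧ not (any (λ Z → ⊊ᵇ X Z ∧ ⊊ᵇ Z Y) (filters n))

indeg : ∀ {n} → Subset n → ℕ
indeg {n} Y = length (filterᵇ (λ X → covers X Y) (filters n))

d⁻ : ℕ → ℕ → ℕ
d⁻ n k = length (filterᵇ (λ Y → indeg Y ≡ᵇ k) (filters n))

-- Formal power series in two variables x, y with integer coefficients,
-- represented by coefficients: S n k = [y^n x^k] S.

Series : Set
Series = ℕ → ℕ → ℤ

sumTo : ℕ → (ℕ → ℤ) → ℤ
sumTo zero    f = f 0
sumTo (suc m) f = sumTo m f +ℤ f (suc m)

_⊛_ : Series → Series → Series
(A ⊛ B) n k = sumTo n (λ i → sumTo k (λ j → A i j *ℤ B (n ∸ i) (k ∸ j)))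

_≋_ : Series → Series → Set
A ≋ B = ∀ n k → A n k ≡ B n k

Dgf : Series
Dgf n k = + d⁻ n k

den : Series
den 0 0 = + 1
den 1 0 = - (+ 1)
den 2 1 = - (+ 1)
den _ _ = + 0

num : Series
num 0 0 = + 1
num 1 1 = + 1
num 3 2 = - (+ 1)
num 4 2 = - (+ 1)
num _ _ = + 0

-- A filter X covers a filter Y in F(φ_n) exactly when X = Y ∖ {m} for a minimal element m
-- of Y, so the indegree of Y is its number of minimal elements.  For N ≥ 5 the element x_N is
-- related within φ_N only to x_{N-1}, and one of the two is extremal: for N odd,
-- x_N < x_{N-1} with x_{N-1} maximal; for N even, x_{N-1} < x_N with x_{N-1} minimal.
-- Sorting the filters of φ_N by their intersection with {x_{N-1}, x_N} gives
-- d⁻_{N,k} = d⁻_{N-1,k} + d⁻_{N-2,k-1}, so the coefficient of yᴺ in (1 - y - xy²)·Σ D⁻_n yⁿ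
-- vanishes for N ≥ 5; the coefficients of y⁰, …, y⁴ are computed by evaluation.

module Submission where

open import Defs
open import Algebra.Structures using (IsMonoid)
open import Data.Bool using (Bool; true; false; _∧_; _∨_; not; _xor_)
open import Data.Bool.ListAction using (any; all)
open import Data.Bool.Properties using (¬-not; T-≡; ∧-isMonoid; ∨-isMonoid; ∧-zeroʳ; ∧-identityʳ; ∨-identityʳ)
open import Data.Empty using (⊥; ⊥-elim)
open import Data.Fin using (Fin; toℕ; _≟_) renaming (zero to fzero; suc to fsuc)
open import Data.Integer using (ℤ; +_; -_) renaming (_+_ to _+ℤ_; _*_ to _*ℤ_)
import Data.Integer.Properties as ℤ
import Data.List as List
open import Data.List using ([]; _∷_; _++_; map; length; filterᵇ; allFin)
open import Data.List.Membership.Propositional using (_∈_)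
open import Data.List.Membership.Propositional.Properties using (∈-allFin; ∈-map⁺; ∈-++⁺ˡ; ∈-++⁺ʳ; ∈-filter⁺)
open import Data.List.Properties using (length-++; filter-++; map-tabulate)
open import Data.List.Relation.Unary.Any using (here; there)
open import Data.Nat using (ℕ; zero; suc; _≡ᵇ_; _≤ᵇ_; _+_; _∸_; _<_; _≤_; z≤n; s≤s; z<s; _%_)
open import Data.Nat.ListAction using (sum)
open import Data.Nat.Properties
  using (+-0-isMonoid; +-commutativeSemigroup; +-comm; +-identityʳ; ≤-refl; ≤-trans; ≤-pred; <-≤-trans;
         n≤1+n; m≤n⇒m≤1+n; m≤n⇒m<n∨m≡n; m≤m+n; <⇒≱; m<n+m; ≡ᵇ⇒≡; ≡⇒≡ᵇ; ≤ᵇ⇒≤; ≤⇒≤ᵇ)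
open import Algebra.Properties.CommutativeSemigroup +-commutativeSemigroup using (interchange; xy∙z≈xz∙y)
open import Data.Product using (Σ-syntax; _×_; _,_; proj₁; proj₂; uncurry)
open import Data.Sum using (_⊎_; inj₁; inj₂; map₁)
open import Data.Vec using ([]; _∷_; _∷ʳ_; _[_]≔_)
open import Data.Vec.Properties using (lookup∘update; lookup∘update′; tabulate∘lookup; tabulate-cong)
open import Function using (_∘_; id; Equivalence)
open import Relation.Binary.PropositionalEquality
open import Relation.Nullary using (¬_; yes; no)
open import Relation.Nullary.Decidable using (⌊_⌋)

private variable A : Set

true≢false : ∀ {b} → b ≡ true → b ≡ false → ⊥
true≢false refl ()

∧-true⁻ : ∀ {a b} → a ∧ b ≡ true → a ≡ true × b ≡ true
∧-true⁻ {true} {true} _ = refl , refl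

∧-true⁺ : ∀ {a b} → a ≡ true → b ≡ true → a ∧ b ≡ true
∧-true⁺ refl refl = refl

∨-true⁻ : ∀ {a b} → a ∨ b ≡ true → a ≡ true ⊎ b ≡ true
∨-true⁻ {true}  _ = inj₁ refl
∨-true⁻ {false} h = inj₂ h

∨-trueˡ : ∀ {a} b → a ≡ true → a ∨ b ≡ true
∨-trueˡ b refl = refl

∨-trueʳ : ∀ a {b} → b ≡ true → a ∨ b ≡ true
∨-trueʳ true  _ = refl
∨-trueʳ false h = h

not-true⁻ : ∀ {a} → not a ≡ true → a ≡ false
not-true⁻ {false} _ = refl

not-false⁻ : ∀ {a} → not a ≡ false → a ≡ true
not-false⁻ {true} _ = refl

¬true⇒false : ∀ {a} → ¬ (a ≡ true) → a ≡ false
¬true⇒false = ¬-not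

⇒ᵇ-elim : ∀ {a b} → not a ∨ b ≡ true → a ≡ true → b ≡ true
⇒ᵇ-elim h refl = h

⇒ᵇ-intro : ∀ {a b} → (a ≡ true → b ≡ true) → not a ∨ b ≡ true
⇒ᵇ-intro {true}  f = f refl
⇒ᵇ-intro {false} f = refl

∧-congˡ-true : ∀ a {x y} → (a ≡ true → x ≡ y) → a ∧ x ≡ a ∧ y
∧-congˡ-true true  e = e refl
∧-congˡ-true false e = refl

bool-ext : ∀ {a b} → (a ≡ true → b ≡ true) → (b ≡ true → a ≡ true) → a ≡ b
bool-ext {true}          f g = sym (f refl)
bool-ext {false} {true}  f g = g refl
bool-ext {false} {false} f g = refl

indicator : Bool → ℕ
indicator true  = 1
indicator false = 0

all-true⁻ : ∀ {p : A → Bool} {xs x} → all p xs ≡ true → x ∈ xs → p x ≡ true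
all-true⁻ h (here refl) = proj₁ (∧-true⁻ h)
all-true⁻ h (there x∈) = all-true⁻ (proj₂ (∧-true⁻ h)) x∈

all-true⁺ : ∀ {p : A → Bool} xs → (∀ {x} → x ∈ xs → p x ≡ true) → all p xs ≡ true
all-true⁺ []       h = refl
all-true⁺ (x ∷ xs) h = ∧-true⁺ (h (here refl)) (all-true⁺ xs (h ∘ there))

all-false⁻ : ∀ {p : A → Bool} xs → all p xs ≡ false → Σ[ x ∈ A ] x ∈ xs × p x ≡ false
all-false⁻ {p = p} (x ∷ xs) h with p x in px
... | false = x , here refl , px
... | true  = let y , y∈ , py = all-false⁻ xs h in y , there y∈ , py

any-true⁻ : ∀ {p : A → Bool} xs → any p xs ≡ true → Σ[ x ∈ A ] x ∈ xs × p x ≡ true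
any-true⁻ {p = p} (x ∷ xs) h with ∨-true⁻ {p x} h
... | inj₁ px = x , here refl , px
... | inj₂ h′ = let y , y∈ , py = any-true⁻ xs h′ in y , there y∈ , py

any-true⁺ : ∀ {p : A → Bool} {xs x} → x ∈ xs → p x ≡ true → any p xs ≡ true
any-true⁺ (here refl) px = ∨-trueˡ _ px
any-true⁺ {p = p} {y ∷ _} (there x∈) px = ∨-trueʳ (p y) (any-true⁺ x∈ px)

count : (n : ℕ) → (Subset n → Bool) → ℕ
count zero    p = indicator (p [])
count (suc n) p = count n (p ∘ (true ∷_)) + count n (p ∘ (false ∷_))

count-cong : ∀ n {p q : Subset n → Bool} → (∀ v → p v ≡ q v) → count n p ≡ count n q
count-cong zero    h = cong indicator (h [])
count-cong (suc n) h = cong₂ _+_ (count-cong n (h ∘ (true ∷_))) (count-cong n (h ∘ (false ∷_)))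

count-false : ∀ n → count n (λ _ → false) ≡ 0
count-false zero    = refl
count-false (suc n) = cong₂ _+_ (count-false n) (count-false n)

length-filterᵇ-++ : ∀ (p : A → Bool) xs ys →
                    length (filterᵇ p (xs ++ ys)) ≡ length (filterᵇ p xs) + length (filterᵇ p ys)
length-filterᵇ-++ p xs ys = trans (cong length (filter-++ _ xs ys)) (length-++ (filterᵇ p xs))

length-filterᵇ-map : ∀ {B : Set} (p : B → Bool) (f : A → B) xs →
                     length (filterᵇ p (map f xs)) ≡ length (filterᵇ (p ∘ f) xs)
length-filterᵇ-map p f []       = refl
length-filterᵇ-map p f (x ∷ xs) with p (f x)
... | true  = cong suc (length-filterᵇ-map p f xs)
... | false = length-filterᵇ-map p f xs

length-filterᵇ-filterᵇ : ∀ (q r : A → Bool) xs →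
                         length (filterᵇ q (filterᵇ r xs)) ≡ length (filterᵇ (λ x → r x ∧ q x) xs)
length-filterᵇ-filterᵇ q r []       = refl
length-filterᵇ-filterᵇ q r (x ∷ xs) with r x
... | false = length-filterᵇ-filterᵇ q r xs
... | true with q x
...   | true  = cong suc (length-filterᵇ-filterᵇ q r xs)
...   | false = length-filterᵇ-filterᵇ q r xs

length-filterᵇ-allSubsets : ∀ n (p : Subset n → Bool) → length (filterᵇ p (allSubsets n)) ≡ count n p
length-filterᵇ-allSubsets zero p with p []
... | true  = refl
... | false = refl
length-filterᵇ-allSubsets (suc n) p = begin
  length (filterᵇ p (map (true ∷_) (allSubsets n) ++ map (false ∷_) (allSubsets n)))
    ≡⟨ length-filterᵇ-++ p (map (true ∷_) (allSubsets n)) _ ⟩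
  length (filterᵇ p (map (true ∷_) (allSubsets n))) + length (filterᵇ p (map (false ∷_) (allSubsets n)))
    ≡⟨ cong₂ _+_ (trans (length-filterᵇ-map p (true ∷_) (allSubsets n)) (length-filterᵇ-allSubsets n _))
                 (trans (length-filterᵇ-map p (false ∷_) (allSubsets n)) (length-filterᵇ-allSubsets n _)) ⟩
  count (suc n) p ∎
  where open ≡-Reasoning

∈-allSubsets : ∀ n (v : Subset n) → v ∈ allSubsets n
∈-allSubsets zero    []          = here refl
∈-allSubsets (suc n) (true ∷ v)  = ∈-++⁺ˡ (∈-map⁺ (true ∷_) (∈-allSubsets n v))
∈-allSubsets (suc n) (false ∷ v) = ∈-++⁺ʳ (map (true ∷_) (allSubsets n)) (∈-map⁺ (false ∷_) (∈-allSubsets n v))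

∈-filters : ∀ {n} {Y : Subset n} → isFilter Y ≡ true → Y ∈ filters n
∈-filters {n} {Y} h = ∈-filter⁺ _ (∈-allSubsets n Y) (Equivalence.from T-≡ h)

-- The index equations are fields rather than constructor indices, so that the view
-- can be matched against open terms such as 5 + double t.
data Generator (a b : ℕ) : Set where
  x₂<x₁ : a ≡ 2 → b ≡ 1 → Generator a b
  x₃<x₂ : a ≡ 3 → b ≡ 2 → Generator a b
  x₂<x₄ : a ≡ 2 → b ≡ 4 → Generator a b
  x₅<x₄ : a ≡ 5 → b ≡ 4 → Generator a b
  x₂ᵢ₋₁<x₂ᵢ : b % 2 ≡ 0 → 6 ≤ b → suc a ≡ b → Generator a b
  x₂ᵢ₊₁<x₂ᵢ : b % 2 ≡ 0 → 6 ≤ b → a ≡ suc b → Generator a b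

≡ᵇ-true⁻ : ∀ {m n} → (m ≡ᵇ n) ≡ true → m ≡ n
≡ᵇ-true⁻ {m} {n} h = ≡ᵇ⇒≡ m n (Equivalence.from T-≡ h)

≡ᵇ-true⁺ : ∀ {m n} → m ≡ n → (m ≡ᵇ n) ≡ true
≡ᵇ-true⁺ {m} refl = Equivalence.to T-≡ (≡⇒≡ᵇ m m refl)

≡ᵇ-pair : ∀ {a b x y} → ((a ≡ᵇ x) ∧ (b ≡ᵇ y)) ≡ true → a ≡ x × b ≡ y
≡ᵇ-pair {a} h = let ax , by = ∧-true⁻ {a ≡ᵇ _} h in ≡ᵇ-true⁻ ax , ≡ᵇ-true⁻ by

gen⇒Generator : ∀ a b → gen a b ≡ true → Generator a b
gen⇒Generator a b h with ∨-true⁻ {(a ≡ᵇ 2) ∧ (b ≡ᵇ 1)} h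
... | inj₁ e = uncurry x₂<x₁ (≡ᵇ-pair e)
... | inj₂ h with ∨-true⁻ {(a ≡ᵇ 3) ∧ (b ≡ᵇ 2)} h
... | inj₁ e = uncurry x₃<x₂ (≡ᵇ-pair e)
... | inj₂ h with ∨-true⁻ {(a ≡ᵇ 2) ∧ (b ≡ᵇ 4)} h
... | inj₁ e = uncurry x₂<x₄ (≡ᵇ-pair e)
... | inj₂ h with ∨-true⁻ {(a ≡ᵇ 5) ∧ (b ≡ᵇ 4)} h
... | inj₁ e = uncurry x₅<x₄ (≡ᵇ-pair e)
... | inj₂ h with ∧-true⁻ {b % 2 ≡ᵇ 0} h
... | b-even , h with ∧-true⁻ {6 ≤ᵇ b} h
... | 6≤b , h with ∨-true⁻ {a + 1 ≡ᵇ b} h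
... | inj₁ e = x₂ᵢ₋₁<x₂ᵢ (≡ᵇ-true⁻ b-even) (≤ᵇ⇒≤ 6 b (Equivalence.from T-≡ 6≤b)) (trans (+-comm 1 a) (≡ᵇ-true⁻ e))
... | inj₂ e = x₂ᵢ₊₁<x₂ᵢ (≡ᵇ-true⁻ b-even) (≤ᵇ⇒≤ 6 b (Equivalence.from T-≡ 6≤b)) (trans (≡ᵇ-true⁻ e) (+-comm b 1))

fence⇒gen : ∀ {a b} → b % 2 ≡ 0 → 6 ≤ b → suc a ≡ b ⊎ a ≡ suc b → gen a b ≡ true
fence⇒gen {a} {b} b-even 6≤b side =
  ∨-trueʳ ((a ≡ᵇ 2) ∧ (b ≡ᵇ 1)) (∨-trueʳ ((a ≡ᵇ 3) ∧ (b ≡ᵇ 2)) (∨-trueʳ ((a ≡ᵇ 2) ∧ (b ≡ᵇ 4))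
    (∨-trueʳ ((a ≡ᵇ 5) ∧ (b ≡ᵇ 4))
      (∧-true⁺ (≡ᵇ-true⁺ b-even) (∧-true⁺ (Equivalence.to T-≡ (≤⇒≤ᵇ 6≤b)) (neighbour side))))))
  where
  neighbour : suc a ≡ b ⊎ a ≡ suc b → ((a + 1 ≡ᵇ b) ∨ (a ≡ᵇ b + 1)) ≡ true
  neighbour (inj₁ e) = ∨-trueˡ _ (≡ᵇ-true⁺ (trans (+-comm a 1) e))
  neighbour (inj₂ e) = ∨-trueʳ _ (≡ᵇ-true⁺ (trans e (+-comm 1 b)))

suc-%2 : ∀ d → suc d % 2 ≡ 1 ∸ d % 2
suc-%2 zero          = refl
suc-%2 (suc zero)    = refl
suc-%2 (suc (suc d)) = suc-%2 d

height : ℕ → ℕ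
height 1 = 2
height 2 = 1
height 4 = 2
height (suc (suc (suc (suc (suc c))))) = c % 2
height _ = 0

even-%2<suc-%2 : ∀ c → c % 2 ≡ 0 → c % 2 < suc c % 2
even-%2<suc-%2 c c-even rewrite suc-%2 c | c-even = s≤s z≤n

Generator⇒height< : ∀ {a b} → Generator a b → height a < height b
Generator⇒height< (x₂<x₁ refl refl) = s≤s (s≤s z≤n)
Generator⇒height< (x₃<x₂ refl refl) = s≤s z≤n
Generator⇒height< (x₂<x₄ refl refl) = s≤s (s≤s z≤n)
Generator⇒height< (x₅<x₄ refl refl) = s≤s z≤n
Generator⇒height< (x₂ᵢ₋₁<x₂ᵢ b-even (s≤s (s≤s (s≤s (s≤s (s≤s (s≤s {n = c} _)))))) refl) = even-%2<suc-%2 c b-even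
Generator⇒height< (x₂ᵢ₊₁<x₂ᵢ b-even (s≤s (s≤s (s≤s (s≤s (s≤s (s≤s {n = c} _)))))) refl) = even-%2<suc-%2 c b-even

cov⇒height< : ∀ {n} {i j : Fin n} → cov i j ≡ true → height (suc (toℕ i)) < height (suc (toℕ j))
cov⇒height< {i = i} {j} c = Generator⇒height< (gen⇒Generator (suc (toℕ i)) (suc (toℕ j)) c)

Closed : ∀ {n} → Subset n → Set
Closed {n} Y = ∀ (i j : Fin n) → cov i j ≡ true → i ∈ᵇ Y ≡ true → j ∈ᵇ Y ≡ true

cov⇒lt : ∀ {n} {i j : Fin n} → cov i j ≡ true → lt i j ≡ true
cov⇒lt {suc n} c = ∨-trueˡ _ c

reach-closed : ∀ {n} {Y : Subset n} → Closed Y → ∀ s i j → reach s i j ≡ true → i ∈ᵇ Y ≡ true → j ∈ᵇ Y ≡ true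
reach-closed {Y = Y} C (suc s) i j h i∈Y with ∨-true⁻ {cov i j} h
... | inj₁ c = C i j c i∈Y
... | inj₂ h with any-true⁻ (allFin _) h
... | k , _ , h = let c , r = ∧-true⁻ {cov i k} h in reach-closed {Y = Y} C s k j r (C i k c i∈Y)

isFilter⇒Closed : ∀ {n} {Y : Subset n} → isFilter Y ≡ true → Closed Y
isFilter⇒Closed {n} {Y} h i j c i∈Y =
  ⇒ᵇ-elim (all-true⁻ (all-true⁻ h (∈-allFin i)) (∈-allFin j)) (∧-true⁺ i∈Y (∨-trueʳ ⌊ i ≟ j ⌋ (cov⇒lt {i = i} {j} c)))

Closed⇒isFilter : ∀ {n} {Y : Subset n} → Closed Y → isFilter Y ≡ true
Closed⇒isFilter {n} {Y} C =
  all-true⁺ (allFin n) λ {i} _ → all-true⁺ (allFin n) λ {j} _ → ⇒ᵇ-intro (upward i j ∘ ∧-true⁻)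
  where
  upward : ∀ i j → i ∈ᵇ Y ≡ true × le i j ≡ true → j ∈ᵇ Y ≡ true
  upward i j (i∈Y , i≤j) with i ≟ j
  ... | yes refl = i∈Y
  ... | no _     = reach-closed {Y = Y} C n i j i≤j i∈Y

minimal : ∀ {n} → Subset n → Fin n → Bool
minimal {n} Y m = not (any (λ j → cov j m ∧ j ∈ᵇ Y) (allFin n))

minimal-true⁻ : ∀ {n} {Y : Subset n} {m} → minimal Y m ≡ true → ∀ j → cov j m ≡ true → j ∈ᵇ Y ≡ false
minimal-true⁻ h j c = ¬true⇒false λ j∈Y → true≢false (any-true⁺ (∈-allFin j) (∧-true⁺ c j∈Y)) (not-true⁻ h)

minimal-false⁻ : ∀ {n} {Y : Subset n} {m} → minimal Y m ≡ false → Σ[ j ∈ Fin n ] cov j m ≡ true × j ∈ᵇ Y ≡ true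
minimal-false⁻ {n} h = let j , _ , e = any-true⁻ (allFin n) (not-false⁻ h) in j , ∧-true⁻ e

_⊆_ : ∀ {n} → Subset n → Subset n → Set
X ⊆ Y = ∀ i → i ∈ᵇ X ≡ true → i ∈ᵇ Y ≡ true

⊆-antisym : ∀ {n} {X Y : Subset n} → X ⊆ Y → Y ⊆ X → X ≡ Y
⊆-antisym {X = X} {Y} X⊆Y Y⊆X =
  trans (sym (tabulate∘lookup X)) (trans (tabulate-cong (λ i → bool-ext (X⊆Y i) (Y⊆X i))) (tabulate∘lookup Y))

⊆ᵇ-true⁺ : ∀ {n} {X Y : Subset n} → X ⊆ Y → ⊆ᵇ X Y ≡ true
⊆ᵇ-true⁺ {n} X⊆Y = all-true⁺ (allFin n) λ {i} _ → ⇒ᵇ-intro (X⊆Y i)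

⊆ᵇ-true⁻ : ∀ {n} {X Y : Subset n} → ⊆ᵇ X Y ≡ true → X ⊆ Y
⊆ᵇ-true⁻ h i = ⇒ᵇ-elim (all-true⁻ h (∈-allFin i))

⊆ᵇ-false⁻ : ∀ {n} {X Y : Subset n} → ⊆ᵇ X Y ≡ false → Σ[ i ∈ Fin n ] i ∈ᵇ X ≡ true × i ∈ᵇ Y ≡ false
⊆ᵇ-false⁻ {n} {X} {Y} h with all-false⁻ (allFin n) h
... | i , _ , e with i ∈ᵇ X in i∈X | i ∈ᵇ Y in i∈Y
... | true  | false = i , i∈X , i∈Y
... | true  | true  = ⊥-elim (true≢false refl e)
... | false | _     = ⊥-elim (true≢false refl e)

⊊ᵇ-true⁺ : ∀ {n} {X Y : Subset n} {i} → X ⊆ Y → i ∈ᵇ Y ≡ true → i ∈ᵇ X ≡ false → ⊊ᵇ X Y ≡ true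
⊊ᵇ-true⁺ {X = X} {Y} {i} X⊆Y i∈Y i∉X =
  ∧-true⁺ (⊆ᵇ-true⁺ {X = X} {Y} X⊆Y) (cong not (¬true⇒false λ h → true≢false (⊆ᵇ-true⁻ {X = Y} {X} h i i∈Y) i∉X))

⊊ᵇ-true⁻ : ∀ {n} {X Y : Subset n} → ⊊ᵇ X Y ≡ true → X ⊆ Y × Σ[ i ∈ Fin n ] i ∈ᵇ Y ≡ true × i ∈ᵇ X ≡ false
⊊ᵇ-true⁻ {X = X} {Y} h =
  let X⊆Y , Y⊈X = ∧-true⁻ {⊆ᵇ X Y} h in ⊆ᵇ-true⁻ {X = X} {Y} X⊆Y , ⊆ᵇ-false⁻ {X = Y} {X} (not-true⁻ Y⊈X)

∈-delete : ∀ {n} (Y : Subset n) {m i} → m ≢ i → i ∈ᵇ (Y [ m ]≔ false) ≡ i ∈ᵇ Y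
∈-delete Y m≢i = lookup∘update′ (m≢i ∘ sym) Y false

delete-⊆ : ∀ {n} (Y : Subset n) m → (Y [ m ]≔ false) ⊆ Y
delete-⊆ Y m i i∈ with m ≟ i
... | yes refl = ⊥-elim (true≢false i∈ (lookup∘update m Y false))
... | no m≢i   = trans (sym (∈-delete Y m≢i)) i∈

⊆-delete : ∀ {n} {W Y : Subset n} {m} → W ⊆ Y → m ∈ᵇ W ≡ false → W ⊆ (Y [ m ]≔ false)
⊆-delete {Y = Y} {m} W⊆Y m∉W i i∈W with m ≟ i
... | yes refl = ⊥-elim (true≢false i∈W m∉W)
... | no m≢i   = trans (∈-delete Y m≢i) (W⊆Y i i∈W)

delete-⊆⇒⊆ : ∀ {n} {Y W : Subset n} {m} → (Y [ m ]≔ false) ⊆ W → m ∈ᵇ W ≡ true → Y ⊆ W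
delete-⊆⇒⊆ {Y = Y} {m = m} Y-m⊆W m∈W i i∈Y with m ≟ i
... | yes refl = m∈W
... | no m≢i   = Y-m⊆W i (trans (∈-delete Y m≢i) i∈Y)

delete-closed : ∀ {n} {Y : Subset n} {m} → Closed Y → minimal Y m ≡ true → Closed (Y [ m ]≔ false)
delete-closed {Y = Y} {m} C min i j c i∈ with m ≟ j
... | yes refl = ⊥-elim (true≢false (delete-⊆ Y m i i∈) (minimal-true⁻ {Y = Y} {m} min i c))
... | no m≢j   = trans (∈-delete Y m≢j) (C i j c (delete-⊆ Y m i i∈))

minimal-outside : ∀ {n} {X Y : Subset n} → Closed X → ∀ i → i ∈ᵇ Y ≡ true → i ∈ᵇ X ≡ false →
                  Σ[ m ∈ Fin n ] m ∈ᵇ Y ≡ true × m ∈ᵇ X ≡ false × minimal Y m ≡ true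
-- Below an element outside the filter X everything is outside X, so descending inside Y
-- stays outside X; the height decreases at each step.
minimal-outside {n} {X} {Y} CX i = descend (suc (height (suc (toℕ i)))) i ≤-refl
  where
  descend : ∀ bound i → height (suc (toℕ i)) < bound → i ∈ᵇ Y ≡ true → i ∈ᵇ X ≡ false →
            Σ[ m ∈ Fin n ] m ∈ᵇ Y ≡ true × m ∈ᵇ X ≡ false × minimal Y m ≡ true
  descend (suc bound) i (s≤s h≤) i∈Y i∉X with minimal Y i in min
  ... | true  = i , i∈Y , i∉X , min
  ... | false with minimal-false⁻ {Y = Y} {i} min
  ... | j , j<i , j∈Y with j ∈ᵇ X in j∈X
  ... | true  = ⊥-elim (true≢false (CX j i j<i j∈X) i∉X)
  ... | false = descend bound j (<-≤-trans (cov⇒height< {i = j} {i} j<i) h≤) j∈Y j∈X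

nothing-between-delete : ∀ {n} (Y W : Subset n) m → (⊊ᵇ (Y [ m ]≔ false) W ∧ ⊊ᵇ W Y) ≡ true → ⊥
nothing-between-delete Y W m h with ∧-true⁻ {⊊ᵇ (Y [ m ]≔ false) W} h
... | Y-m⊊W , W⊊Y with ⊊ᵇ-true⁻ {X = Y [ m ]≔ false} {W} Y-m⊊W | ⊊ᵇ-true⁻ {X = W} {Y} W⊊Y | m ∈ᵇ W in m∈W
... | Y-m⊆W , _ | _ , i , i∈Y , i∉W | true  = true≢false (delete-⊆⇒⊆ {Y = Y} {W} Y-m⊆W m∈W i i∈Y) i∉W
... | _ , i , i∈W , i∉Y-m | W⊆Y , _ | false = true≢false (⊆-delete {W = W} {Y} W⊆Y m∈W i i∈W) i∉Y-m

delete-minimal-isFilter : ∀ {n} (Y : Subset n) m → isFilter Y ≡ true → minimal Y m ≡ true →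
                          isFilter (Y [ m ]≔ false) ≡ true
delete-minimal-isFilter Y m fY min =
  Closed⇒isFilter {Y = Y [ m ]≔ false} (delete-closed {Y = Y} {m} (isFilter⇒Closed {Y = Y} fY) min)

delete-minimal-covers : ∀ {n} (Y : Subset n) m → isFilter Y ≡ true → m ∈ᵇ Y ≡ true → minimal Y m ≡ true →
                         (isFilter (Y [ m ]≔ false) ∧ covers (Y [ m ]≔ false) Y) ≡ true
delete-minimal-covers {n} Y m fY m∈Y min =
  ∧-true⁺ (delete-minimal-isFilter Y m fY min)
    (∧-true⁺ (⊊ᵇ-true⁺ {X = Y [ m ]≔ false} {Y} (delete-⊆ Y m) m∈Y (lookup∘update m Y false))
      (cong not (¬true⇒false λ h →
        let W , _ , between = any-true⁻ (filters n) h in nothing-between-delete Y W m between)))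

covers⇒delete-minimal : ∀ {n} {X Y : Subset n} → isFilter Y ≡ true → (isFilter X ∧ covers X Y) ≡ true →
                         Σ[ m ∈ Fin n ] m ∈ᵇ Y ≡ true × minimal Y m ≡ true × X ≡ Y [ m ]≔ false
covers⇒delete-minimal {n} {X} {Y} fY h with ∧-true⁻ {isFilter X} h
... | fX , cover with ∧-true⁻ {⊊ᵇ X Y} cover
... | X⊊Y , nothing-between with ⊊ᵇ-true⁻ {X = X} {Y} X⊊Y
... | X⊆Y , i , i∈Y , i∉X with minimal-outside {X = X} {Y} (isFilter⇒Closed {Y = X} fX) i i∈Y i∉X
... | m , m∈Y , m∉X , min = m , m∈Y , min , ⊆-antisym {X = X} X⊆Y-m Y-m⊆X
  where
  X⊆Y-m : X ⊆ (Y [ m ]≔ false)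
  X⊆Y-m = ⊆-delete {W = X} {Y} X⊆Y m∉X
  -- otherwise Y ∖ {m} would be a filter strictly between X and Y
  Y-m⊆X : (Y [ m ]≔ false) ⊆ X
  Y-m⊆X with ⊆ᵇ (Y [ m ]≔ false) X in Y-m⊆ᵇX
  ... | true  = ⊆ᵇ-true⁻ {X = Y [ m ]≔ false} {X} Y-m⊆ᵇX
  ... | false = ⊥-elim (true≢false between (not-true⁻ nothing-between))
    where
    between : any (λ Z → ⊊ᵇ X Z ∧ ⊊ᵇ Z Y) (filters n) ≡ true
    between = any-true⁺ {p = λ Z → ⊊ᵇ X Z ∧ ⊊ᵇ Z Y} {x = Y [ m ]≔ false}
                (∈-filters (delete-minimal-isFilter Y m fY min))
                (∧-true⁺ (∧-true⁺ (⊆ᵇ-true⁺ {X = X} {Y [ m ]≔ false} X⊆Y-m) (cong not Y-m⊆ᵇX))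
                         (⊊ᵇ-true⁺ {X = Y [ m ]≔ false} {Y} (delete-⊆ Y m) m∈Y (lookup∘update m Y false)))

_==_ : ∀ {n} → Subset n → Subset n → Bool
[]      == []      = true
(x ∷ X) == (y ∷ Y) = not (x xor y) ∧ X == Y

==-true⁻ : ∀ {n} (X Y : Subset n) → X == Y ≡ true → X ≡ Y
==-true⁻ []          []          _ = refl
==-true⁻ (true ∷ X)  (true ∷ Y)  h = cong (true ∷_) (==-true⁻ X Y h)
==-true⁻ (false ∷ X) (false ∷ Y) h = cong (false ∷_) (==-true⁻ X Y h)

==-refl : ∀ {n} (X : Subset n) → X == X ≡ true
==-refl []          = refl
==-refl (true ∷ X)  = ==-refl X
==-refl (false ∷ X) = ==-refl X

count-== : ∀ n (Y : Subset n) → count n (Y ==_) ≡ 1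
count-== zero    []          = refl
count-== (suc n) (true ∷ Y)  = cong₂ _+_ (count-== n Y) (count-false n)
count-== (suc n) (false ∷ Y) = cong₂ _+_ (count-false n) (count-== n Y)

-- deletesOne m Y X: X is Y with a single element i satisfying m i removed.
deletesOne : ∀ {n} → (Fin n → Bool) → Subset n → Subset n → Bool
deletesOne m []      []      = false
deletesOne m (y ∷ Y) (x ∷ X) = (y ∧ not x ∧ m fzero ∧ Y == X) ∨ (not (x xor y) ∧ deletesOne (m ∘ fsuc) Y X)

deletesOne-true⁻ : ∀ {n} m (Y X : Subset n) → deletesOne m Y X ≡ true →
                   Σ[ i ∈ Fin n ] i ∈ᵇ Y ≡ true × m i ≡ true × X ≡ Y [ i ]≔ false
deletesOne-true⁻ m []          []          ()
deletesOne-true⁻ m (false ∷ Y) (true ∷ X)  ()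
deletesOne-true⁻ m (true ∷ Y) (false ∷ X) h =
  let m0 , Y=X = ∧-true⁻ {m fzero} (trans (sym (∨-identityʳ _)) h)
  in fzero , refl , m0 , cong (false ∷_) (sym (==-true⁻ Y X Y=X))
deletesOne-true⁻ m (true ∷ Y) (true ∷ X) h =
  let i , i∈Y , mi , X≡ = deletesOne-true⁻ (m ∘ fsuc) Y X h in fsuc i , i∈Y , mi , cong (true ∷_) X≡
deletesOne-true⁻ m (false ∷ Y) (false ∷ X) h =
  let i , i∈Y , mi , X≡ = deletesOne-true⁻ (m ∘ fsuc) Y X h in fsuc i , i∈Y , mi , cong (false ∷_) X≡

deletesOne-true⁺ : ∀ {n} m (Y : Subset n) i → i ∈ᵇ Y ≡ true → m i ≡ true →
                   deletesOne m Y (Y [ i ]≔ false) ≡ true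
deletesOne-true⁺ m (true ∷ Y)  fzero    refl m0 = ∨-trueˡ _ (∧-true⁺ m0 (==-refl Y))
deletesOne-true⁺ m (true ∷ Y)  (fsuc i) i∈Y  mi = deletesOne-true⁺ (m ∘ fsuc) Y i i∈Y mi
deletesOne-true⁺ m (false ∷ Y) (fsuc i) i∈Y  mi = deletesOne-true⁺ (m ∘ fsuc) Y i i∈Y mi

countFin : ∀ n → (Fin n → Bool) → ℕ
countFin n q = sum (List.tabulate (indicator ∘ q))

count-deletesOne : ∀ n m (Y : Subset n) → count n (deletesOne m Y) ≡ countFin n (λ i → i ∈ᵇ Y ∧ m i)
count-deletesOne zero    m []         = refl
count-deletesOne (suc n) m (true ∷ Y) with m fzero
... | true  = trans (cong₂ _+_ (count-deletesOne n (m ∘ fsuc) Y)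
                               (trans (count-cong n (λ X → ∨-identityʳ (Y == X))) (count-== n Y)))
                    (+-comm _ 1)
... | false = trans (cong₂ _+_ (count-deletesOne n (m ∘ fsuc) Y) (count-false n)) (+-identityʳ _)
count-deletesOne (suc n) m (false ∷ Y) = cong₂ _+_ (count-false n) (count-deletesOne n (m ∘ fsuc) Y)

covers≡deletesOne-minimal : ∀ {n} {Y : Subset n} → isFilter Y ≡ true →
                            ∀ X → (isFilter X ∧ covers X Y) ≡ deletesOne (minimal Y) Y X
covers≡deletesOne-minimal {Y = Y} fY X = bool-ext covers⇒deletes deletes⇒covers
  where
  covers⇒deletes : (isFilter X ∧ covers X Y) ≡ true → deletesOne (minimal Y) Y X ≡ true
  covers⇒deletes h =
    let m , m∈Y , min , X≡ = covers⇒delete-minimal {X = X} {Y} fY h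
    in subst (λ Z → deletesOne (minimal Y) Y Z ≡ true) (sym X≡) (deletesOne-true⁺ (minimal Y) Y m m∈Y min)
  deletes⇒covers : deletesOne (minimal Y) Y X ≡ true → (isFilter X ∧ covers X Y) ≡ true
  deletes⇒covers h =
    let m , m∈Y , min , X≡ = deletesOne-true⁻ (minimal Y) Y X h
    in subst (λ Z → (isFilter Z ∧ covers Z Y) ≡ true) (sym X≡) (delete-minimal-covers Y m fY m∈Y min)

#minimalᶠ : ∀ {n} → Subset n → ℕ
#minimalᶠ {n} Y = countFin n (λ i → i ∈ᵇ Y ∧ minimal Y i)

indeg≡#minimalᶠ : ∀ {n} {Y : Subset n} → isFilter Y ≡ true → indeg Y ≡ #minimalᶠ Y
indeg≡#minimalᶠ {n} {Y} fY = begin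
  indeg Y
    ≡⟨ length-filterᵇ-filterᵇ (λ X → covers X Y) isFilter (allSubsets n) ⟩
  length (filterᵇ (λ X → isFilter X ∧ covers X Y) (allSubsets n))
    ≡⟨ length-filterᵇ-allSubsets n _ ⟩
  count n (λ X → isFilter X ∧ covers X Y)
    ≡⟨ count-cong n (covers≡deletesOne-minimal {Y = Y} fY) ⟩
  count n (deletesOne (minimal Y) Y)
    ≡⟨ count-deletesOne n (minimal Y) Y ⟩
  #minimalᶠ Y ∎
  where open ≡-Reasoning

module BigOp {A : Set} {_∙_ : A → A → A} {ε : A} (M : IsMonoid _≡_ _∙_ ε) where
  open IsMonoid M using (assoc; identityˡ; identityʳ)

  ⨁ : ℕ → (ℕ → A) → A
  ⨁ zero    f = ε
  ⨁ (suc n) f = ⨁ n f ∙ f (suc n)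

  ⨁-cong : ∀ n {f g : ℕ → A} → (∀ a → 1 ≤ a → a ≤ n → f a ≡ g a) → ⨁ n f ≡ ⨁ n g
  ⨁-cong zero    e = refl
  ⨁-cong (suc n) e = cong₂ _∙_ (⨁-cong n λ a 1≤a a≤n → e a 1≤a (m≤n⇒m≤1+n a≤n)) (e (suc n) (s≤s z≤n) ≤-refl)

  ⨁-suc : ∀ n f → ⨁ (suc n) f ≡ f 1 ∙ ⨁ n (f ∘ suc)
  ⨁-suc zero    f = trans (identityˡ (f 1)) (sym (identityʳ (f 1)))
  ⨁-suc (suc n) f = trans (cong (_∙ f (2 + n)) (⨁-suc n f)) (assoc (f 1) _ _)

  foldr-tabulate : ∀ n {f : Fin n → A} {g : ℕ → A} → (∀ i → f i ≡ g (suc (toℕ i))) →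
                   List.foldr _∙_ ε (List.tabulate f) ≡ ⨁ n g
  foldr-tabulate zero    e = refl
  foldr-tabulate (suc n) {g = g} e = trans (cong₂ _∙_ (e fzero) (foldr-tabulate n (e ∘ fsuc))) (sym (⨁-suc n g))

allUpTo : ℕ → (ℕ → Bool) → Bool
allUpTo = BigOp.⨁ ∧-isMonoid

anyUpTo : ℕ → (ℕ → Bool) → Bool
anyUpTo = BigOp.⨁ ∨-isMonoid

countUpTo : ℕ → (ℕ → Bool) → ℕ
countUpTo n q = BigOp.⨁ +-0-isMonoid n (indicator ∘ q)

≤-suc⁻ : ∀ {a n} → a ≤ suc n → a ≤ n ⊎ a ≡ suc n
≤-suc⁻ a≤1+n = map₁ ≤-pred (m≤n⇒m<n∨m≡n a≤1+n)

allUpTo-true⁻ : ∀ n {q} → allUpTo n q ≡ true → ∀ a → 1 ≤ a → a ≤ n → q a ≡ true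
allUpTo-true⁻ zero    h (suc a) 1≤a ()
allUpTo-true⁻ (suc n) {q} h a 1≤a a≤1+n with ≤-suc⁻ a≤1+n
... | inj₁ a≤n  = allUpTo-true⁻ n (proj₁ (∧-true⁻ {allUpTo n q} h)) a 1≤a a≤n
... | inj₂ refl = proj₂ (∧-true⁻ {allUpTo n q} h)

allUpTo-true⁺ : ∀ n {q} → (∀ a → 1 ≤ a → a ≤ n → q a ≡ true) → allUpTo n q ≡ true
allUpTo-true⁺ zero    h = refl
allUpTo-true⁺ (suc n) h = ∧-true⁺ (allUpTo-true⁺ n λ a 1≤a a≤n → h a 1≤a (m≤n⇒m≤1+n a≤n)) (h (suc n) (s≤s z≤n) ≤-refl)

anyUpTo-true⁻ : ∀ n {q} → anyUpTo n q ≡ true → Σ[ a ∈ ℕ ] 1 ≤ a × a ≤ n × q a ≡ true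
anyUpTo-true⁻ (suc n) {q} h with ∨-true⁻ {anyUpTo n q} h
... | inj₂ qn = suc n , s≤s z≤n , ≤-refl , qn
... | inj₁ h  = let a , 1≤a , a≤n , qa = anyUpTo-true⁻ n h in a , 1≤a , m≤n⇒m≤1+n a≤n , qa

anyUpTo-true⁺ : ∀ n {q} a → 1 ≤ a → a ≤ n → q a ≡ true → anyUpTo n q ≡ true
anyUpTo-true⁺ zero    (suc a) 1≤a ()
anyUpTo-true⁺ (suc n) {q} a 1≤a a≤1+n qa with ≤-suc⁻ a≤1+n
... | inj₁ a≤n  = ∨-trueˡ _ (anyUpTo-true⁺ n a 1≤a a≤n qa)
... | inj₂ refl = ∨-trueʳ (anyUpTo n q) qa

anyUpTo-false : ∀ n {q} → (∀ a → q a ≡ false) → anyUpTo n q ≡ false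
anyUpTo-false zero    h = refl
anyUpTo-false (suc n) h rewrite anyUpTo-false n h | h (suc n) = refl

all-allFin : ∀ n {p : Fin n → Bool} {q : ℕ → Bool} → (∀ i → p i ≡ q (suc (toℕ i))) →
             all p (allFin n) ≡ allUpTo n q
all-allFin n {p} e = trans (cong (List.foldr _∧_ true) (map-tabulate id p)) (BigOp.foldr-tabulate ∧-isMonoid n e)

any-allFin : ∀ n {p : Fin n → Bool} {q : ℕ → Bool} → (∀ i → p i ≡ q (suc (toℕ i))) →
             any p (allFin n) ≡ anyUpTo n q
any-allFin n {p} e = trans (cong (List.foldr _∨_ false) (map-tabulate id p)) (BigOp.foldr-tabulate ∨-isMonoid n e)

-- ⟦ Y ⟧ a says whether x_a ∈ Y; indices are 1-based and ⟦ Y ⟧ is false outside 1 ≤ a ≤ n.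
⟦_⟧ : ∀ {n} → Subset n → ℕ → Bool
⟦ [] ⟧    _             = false
⟦ b ∷ Y ⟧ zero          = false
⟦ b ∷ Y ⟧ (suc zero)    = b
⟦ b ∷ Y ⟧ (suc (suc a)) = ⟦ Y ⟧ (suc a)

∈ᵇ≡⟦⟧ : ∀ {n} (Y : Subset n) i → i ∈ᵇ Y ≡ ⟦ Y ⟧ (suc (toℕ i))
∈ᵇ≡⟦⟧ (y ∷ Y) fzero    = refl
∈ᵇ≡⟦⟧ (y ∷ Y) (fsuc i) = ∈ᵇ≡⟦⟧ Y i

isClosed : ℕ → (ℕ → Bool) → Bool
isClosed N P = allUpTo N λ a → allUpTo N λ c → not (gen a c ∧ P a) ∨ P c

isMinimal : ℕ → (ℕ → Bool) → ℕ → Bool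
isMinimal N P a = P a ∧ not (anyUpTo N λ c → gen c a ∧ P c)

#minimal : ℕ → (ℕ → Bool) → ℕ
#minimal N P = countUpTo N (isMinimal N P)

isFilter≡isClosed : ∀ {n} (Y : Subset n) → isFilter Y ≡ isClosed n ⟦ Y ⟧
isFilter≡isClosed {n} Y = trans (bool-ext filter⇒covClosed covClosed⇒filter) covClosed≡isClosed
  where
  covClosed : Bool
  covClosed = all (λ i → all (λ j → not (cov i j ∧ i ∈ᵇ Y) ∨ j ∈ᵇ Y) (allFin n)) (allFin n)
  filter⇒covClosed : isFilter Y ≡ true → covClosed ≡ true
  filter⇒covClosed fY = all-true⁺ (allFin n) λ {i} _ → all-true⁺ (allFin n) λ {j} _ →
    ⇒ᵇ-intro λ h → let c , i∈Y = ∧-true⁻ {cov i j} h in isFilter⇒Closed {Y = Y} fY i j c i∈Y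
  covClosed⇒filter : covClosed ≡ true → isFilter Y ≡ true
  covClosed⇒filter h = Closed⇒isFilter {Y = Y} λ i j c i∈Y →
    ⇒ᵇ-elim (all-true⁻ (all-true⁻ h (∈-allFin i)) (∈-allFin j)) (∧-true⁺ c i∈Y)
  covClosed≡isClosed : covClosed ≡ isClosed n ⟦ Y ⟧
  covClosed≡isClosed = all-allFin n λ i → all-allFin n λ j →
    cong₂ (λ u v → not (cov i j ∧ u) ∨ v) (∈ᵇ≡⟦⟧ Y i) (∈ᵇ≡⟦⟧ Y j)

#minimalᶠ≡#minimal : ∀ {n} (Y : Subset n) → #minimalᶠ Y ≡ #minimal n ⟦ Y ⟧
#minimalᶠ≡#minimal {n} Y = BigOp.foldr-tabulate +-0-isMonoid n λ i →
  cong indicator (cong₂ _∧_ (∈ᵇ≡⟦⟧ Y i) (cong not (any-allFin n λ j → cong (cov j i ∧_) (∈ᵇ≡⟦⟧ Y j))))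

isFilterWith : ℕ → (ℕ → Bool) → (ℕ → Bool) → Bool
isFilterWith N test P = isClosed N P ∧ test (#minimal N P)

-- The number of minimal elements is checked by an arbitrary test, so that the shift
-- k ↦ k - 1 in the recurrence is just test ∘ suc.
filterCount : ℕ → (ℕ → Bool) → ℕ
filterCount n test = count n (isFilterWith n test ∘ ⟦_⟧)

d⁻≡filterCount : ∀ n k → d⁻ n k ≡ filterCount n (_≡ᵇ k)
d⁻≡filterCount n k = begin
  d⁻ n k
    ≡⟨ length-filterᵇ-filterᵇ (λ Y → indeg Y ≡ᵇ k) isFilter (allSubsets n) ⟩
  length (filterᵇ (λ Y → isFilter Y ∧ (indeg Y ≡ᵇ k)) (allSubsets n))
    ≡⟨ length-filterᵇ-allSubsets n _ ⟩
  count n (λ Y → isFilter Y ∧ (indeg Y ≡ᵇ k))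
    ≡⟨ count-cong n pointwise ⟩
  filterCount n (_≡ᵇ k) ∎
  where
  open ≡-Reasoning
  pointwise : ∀ Y → (isFilter Y ∧ (indeg Y ≡ᵇ k)) ≡ isFilterWith n (_≡ᵇ k) ⟦ Y ⟧
  pointwise Y = trans
    (∧-congˡ-true (isFilter Y) λ fY → cong (_≡ᵇ k) (trans (indeg≡#minimalᶠ {Y = Y} fY) (#minimalᶠ≡#minimal Y)))
    (cong (_∧ (#minimal n ⟦ Y ⟧ ≡ᵇ k)) (isFilter≡isClosed Y))

ClosedUpTo : ℕ → (ℕ → Bool) → Set
ClosedUpTo N P = ∀ a c → 1 ≤ a → a ≤ N → 1 ≤ c → c ≤ N → gen a c ≡ true → P a ≡ true → P c ≡ true

isClosed-true⁻ : ∀ N {P} → isClosed N P ≡ true → ClosedUpTo N P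
isClosed-true⁻ N h a c 1≤a a≤N 1≤c c≤N g Pa =
  ⇒ᵇ-elim (allUpTo-true⁻ N (allUpTo-true⁻ N h a 1≤a a≤N) c 1≤c c≤N) (∧-true⁺ g Pa)

isClosed-true⁺ : ∀ N {P} → ClosedUpTo N P → isClosed N P ≡ true
isClosed-true⁺ N C = allUpTo-true⁺ N λ a 1≤a a≤N → allUpTo-true⁺ N λ c 1≤c c≤N →
  ⇒ᵇ-intro λ h → let g , Pa = ∧-true⁻ {gen a c} h in C a c 1≤a a≤N 1≤c c≤N g Pa

ClosedUpTo-pred : ∀ N {P} → ClosedUpTo (suc N) P → ClosedUpTo N P
ClosedUpTo-pred N C a c 1≤a a≤N 1≤c c≤N = C a c 1≤a (m≤n⇒m≤1+n a≤N) 1≤c (m≤n⇒m≤1+n c≤N)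

isClosed-suc-absent : ∀ N {P} → P (suc N) ≡ false → (∀ a → a ≤ N → gen a (suc N) ≡ true → P a ≡ false) →
                      isClosed (suc N) P ≡ isClosed N P
isClosed-suc-absent N {P} absent below = bool-ext
  (isClosed-true⁺ N ∘ ClosedUpTo-pred N ∘ isClosed-true⁻ (suc N))
  (λ h → isClosed-true⁺ (suc N) (extend (isClosed-true⁻ N h)))
  where
  extend : ClosedUpTo N P → ClosedUpTo (suc N) P
  extend C a c 1≤a a≤ 1≤c c≤ g Pa with ≤-suc⁻ a≤ | ≤-suc⁻ c≤
  ... | inj₂ refl | _         = ⊥-elim (true≢false Pa absent)
  ... | inj₁ a≤N  | inj₁ c≤N  = C a c 1≤a a≤N 1≤c c≤N g Pa
  ... | inj₁ a≤N  | inj₂ refl = ⊥-elim (true≢false Pa (below a a≤N g))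

isClosed-suc-present : ∀ N {P} → P (suc N) ≡ true → (∀ c → c ≤ N → gen (suc N) c ≡ true → P c ≡ true) →
                       isClosed (suc N) P ≡ isClosed N P
isClosed-suc-present N {P} present above = bool-ext
  (isClosed-true⁺ N ∘ ClosedUpTo-pred N ∘ isClosed-true⁻ (suc N))
  (λ h → isClosed-true⁺ (suc N) (extend (isClosed-true⁻ N h)))
  where
  extend : ClosedUpTo N P → ClosedUpTo (suc N) P
  extend C a c 1≤a a≤ 1≤c c≤ g Pa with ≤-suc⁻ a≤ | ≤-suc⁻ c≤
  ... | _         | inj₂ refl = present
  ... | inj₁ a≤N  | inj₁ c≤N  = C a c 1≤a a≤N 1≤c c≤N g Pa
  ... | inj₂ refl | inj₁ c≤N  = above c c≤N g

∧-not-∨ : ∀ x y z → x ∧ not (y ∨ z) ≡ (x ∧ not y) ∧ not z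
∧-not-∨ true  true  z = refl
∧-not-∨ true  false z = refl
∧-not-∨ false y     z = refl

isMinimal-suc-unaffected : ∀ N P a → (gen (suc N) a ∧ P (suc N)) ≡ false →
                           isMinimal (suc N) P a ≡ isMinimal N P a
isMinimal-suc-unaffected N P a unaffected = begin
  P a ∧ not (anyUpTo N (λ c → gen c a ∧ P c) ∨ (gen (suc N) a ∧ P (suc N)))
    ≡⟨ ∧-not-∨ (P a) _ _ ⟩
  isMinimal N P a ∧ not (gen (suc N) a ∧ P (suc N))
    ≡⟨ cong (λ b → isMinimal N P a ∧ not b) unaffected ⟩
  isMinimal N P a ∧ true
    ≡⟨ ∧-identityʳ _ ⟩
  isMinimal N P a ∎
  where open ≡-Reasoning

countUpTo-cong : ∀ N {q r} → (∀ a → a ≤ N → q a ≡ r a) → countUpTo N q ≡ countUpTo N r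
countUpTo-cong N e = BigOp.⨁-cong +-0-isMonoid N λ a _ a≤N → cong indicator (e a a≤N)

#minimal-suc-absent : ∀ N {P} → P (suc N) ≡ false → #minimal (suc N) P ≡ #minimal N P
#minimal-suc-absent N {P} absent = trans
  (cong₂ _+_ (countUpTo-cong N λ a _ →
                isMinimal-suc-unaffected N P a (trans (cong (gen (suc N) a ∧_) absent) (∧-zeroʳ _)))
             (cong (λ b → indicator (b ∧ not (anyUpTo (suc N) λ c → gen c (suc N) ∧ P c))) absent))
  (+-identityʳ _)

#minimal-suc-maximal : ∀ N {P} → (∀ c → gen (suc N) c ≡ false) →
                       #minimal (suc N) P ≡ #minimal N P + indicator (isMinimal (suc N) P (suc N))
#minimal-suc-maximal N {P} maximal = cong (_+ indicator (isMinimal (suc N) P (suc N)))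
  (countUpTo-cong N λ a _ → isMinimal-suc-unaffected N P a (cong (_∧ P (suc N)) (maximal a)))

isClosed-false : ∀ N {P} a c → 1 ≤ a → a ≤ N → 1 ≤ c → c ≤ N → gen a c ≡ true → P a ≡ true → P c ≡ false →
                 isClosed N P ≡ false
isClosed-false N a c 1≤a a≤N 1≤c c≤N g Pa Pc =
  ¬true⇒false λ closed → true≢false (isClosed-true⁻ N closed a c 1≤a a≤N 1≤c c≤N g Pa) Pc

isFilterWith-cong : ∀ N test {P Q} → (∀ a → a ≤ N → P a ≡ Q a) → isFilterWith N test P ≡ isFilterWith N test Q
isFilterWith-cong N test e = cong₂ (λ closed m → closed ∧ test m)
  (BigOp.⨁-cong ∧-isMonoid N λ a _ a≤N → BigOp.⨁-cong ∧-isMonoid N λ c _ c≤N →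
    cong₂ (λ u v → not (gen a c ∧ u) ∨ v) (e a a≤N) (e c c≤N))
  (BigOp.⨁-cong +-0-isMonoid N λ a _ a≤N → cong indicator (cong₂ (λ u v → u ∧ not v) (e a a≤N)
    (BigOp.⨁-cong ∨-isMonoid N λ c _ c≤N → cong (gen c a ∧_) (e c c≤N))))

double : ℕ → ℕ
double zero    = zero
double (suc t) = suc (suc (double t))

double-%2 : ∀ t → double t % 2 ≡ 0
double-%2 zero    = refl
double-%2 (suc t) = double-%2 t

odd-%2≢0 : ∀ t → suc (double t) % 2 ≢ 0
odd-%2≢0 zero    ()
odd-%2≢0 (suc t) = odd-%2≢0 t

double≢1 : ∀ t → double t ≢ 1
double≢1 zero    ()
double≢1 (suc t) ()

nothing-above-even : ∀ t c → gen (4 + double t) c ≡ false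
nothing-above-even t c = ¬true⇒false (absurd ∘ gen⇒Generator (4 + double t) c)
  where
  absurd : ∀ {c} → Generator (4 + double t) c → ⊥
  absurd (x₂<x₁ () _)
  absurd (x₃<x₂ () _)
  absurd (x₂<x₄ () _)
  absurd (x₅<x₄ e _)             = double≢1 t (cong (_∸ 4) e)
  absurd (x₂ᵢ₋₁<x₂ᵢ b-even _ refl) = odd-%2≢0 t b-even
  absurd (x₂ᵢ₊₁<x₂ᵢ b-even _ refl) = odd-%2≢0 t b-even

nothing-below-odd : ∀ t a → gen a (5 + double t) ≡ false
nothing-below-odd t a = ¬true⇒false (absurd ∘ gen⇒Generator a (5 + double t))
  where
  absurd : Generator a (5 + double t) → ⊥
  absurd (x₂<x₁ _ ())
  absurd (x₃<x₂ _ ())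
  absurd (x₂<x₄ _ ())
  absurd (x₅<x₄ _ ())
  absurd (x₂ᵢ₋₁<x₂ᵢ b-even _ _) = odd-%2≢0 t b-even
  absurd (x₂ᵢ₊₁<x₂ᵢ b-even _ _) = odd-%2≢0 t b-even

above-odd : ∀ t c → gen (5 + double t) c ≡ true → c ≡ 4 + double t ⊎ c ≡ 6 + double t
above-odd t c = cases ∘ gen⇒Generator (5 + double t) c
  where
  cases : ∀ {c} → Generator (5 + double t) c → c ≡ 4 + double t ⊎ c ≡ 6 + double t
  cases (x₂<x₁ () _)
  cases (x₃<x₂ () _)
  cases (x₂<x₄ () _)
  cases (x₅<x₄ e refl)        = inj₁ (cong (_∸ 1) (sym e))
  cases (x₂ᵢ₋₁<x₂ᵢ _ _ refl) = inj₂ refl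
  cases (x₂ᵢ₊₁<x₂ᵢ _ _ refl) = inj₁ refl

below-even : ∀ t a → gen a (6 + double t) ≡ true → a ≡ 5 + double t ⊎ a ≡ 7 + double t
below-even t a = cases ∘ gen⇒Generator a (6 + double t)
  where
  cases : ∀ {a} → Generator a (6 + double t) → a ≡ 5 + double t ⊎ a ≡ 7 + double t
  cases (x₂<x₁ _ ())
  cases (x₃<x₂ _ ())
  cases (x₂<x₄ _ ())
  cases (x₅<x₄ _ ())
  cases (x₂ᵢ₋₁<x₂ᵢ _ _ refl) = inj₁ refl
  cases (x₂ᵢ₊₁<x₂ᵢ _ _ refl) = inj₂ refl

odd<pred : ∀ t → gen (5 + double t) (4 + double t) ≡ true
odd<pred zero    = refl
odd<pred (suc t) = fence⇒gen (double-%2 t) (m≤m+n 6 (double t)) (inj₂ refl)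

odd<suc : ∀ t → gen (5 + double t) (6 + double t) ≡ true
odd<suc t = fence⇒gen (double-%2 t) (m≤m+n 6 (double t)) (inj₁ refl)

1+k+x≰x : ∀ k x → ¬ (suc k + x ≤ x)
1+k+x≰x k x = <⇒≱ (m<n+m x z<s)

count-∷ʳ : ∀ n (p : Subset (suc n) → Bool) →
           count (suc n) p ≡ count n (p ∘ (_∷ʳ true)) + count n (p ∘ (_∷ʳ false))
count-∷ʳ zero    p = refl
count-∷ʳ (suc n) p = trans (cong₂ _+_ (count-∷ʳ n (p ∘ (true ∷_))) (count-∷ʳ n (p ∘ (false ∷_))))
  (interchange (count n λ v → p (true ∷ (v ∷ʳ true))) (count n λ v → p (true ∷ (v ∷ʳ false)))
               (count n λ v → p (false ∷ (v ∷ʳ true))) (count n λ v → p (false ∷ (v ∷ʳ false))))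

⟦∷ʳ⟧-old : ∀ {n} (v : Subset n) b a → a ≤ n → ⟦ v ∷ʳ b ⟧ a ≡ ⟦ v ⟧ a
⟦∷ʳ⟧-old []      b zero          _         = refl
⟦∷ʳ⟧-old (x ∷ v) b zero          _         = refl
⟦∷ʳ⟧-old (x ∷ v) b (suc zero)    _         = refl
⟦∷ʳ⟧-old (x ∷ v) b (suc (suc a)) (s≤s a≤n) = ⟦∷ʳ⟧-old v b (suc a) a≤n

⟦∷ʳ⟧-new : ∀ {n} (v : Subset n) b → ⟦ v ∷ʳ b ⟧ (suc n) ≡ b
⟦∷ʳ⟧-new []      b = refl
⟦∷ʳ⟧-new (x ∷ v) b = ⟦∷ʳ⟧-new v b

⟦∷ʳ∷ʳ⟧-middle : ∀ {n} (v : Subset n) c b → ⟦ v ∷ʳ c ∷ʳ b ⟧ (suc n) ≡ c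
⟦∷ʳ∷ʳ⟧-middle {n} v c b = trans (⟦∷ʳ⟧-old (v ∷ʳ c) b (suc n) ≤-refl) (⟦∷ʳ⟧-new v c)

isFilterWith-∷ʳ : ∀ N test {n} (v : Subset n) b → N ≤ n →
                  isFilterWith N test ⟦ v ∷ʳ b ⟧ ≡ isFilterWith N test ⟦ v ⟧
isFilterWith-∷ʳ N test v b N≤n = isFilterWith-cong N test λ a a≤N → ⟦∷ʳ⟧-old v b a (≤-trans a≤N N≤n)

isFilterWith-∷ʳ∷ʳ : ∀ N test (v : Subset N) c b →
                    isFilterWith N test ⟦ v ∷ʳ c ∷ʳ b ⟧ ≡ isFilterWith N test ⟦ v ⟧
isFilterWith-∷ʳ∷ʳ N test v c b =
  trans (isFilterWith-∷ʳ N test (v ∷ʳ c) b (n≤1+n N)) (isFilterWith-∷ʳ N test v c ≤-refl)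

extending : ℕ → Bool → (ℕ → Bool) → ℕ
extending n b test = count n (λ v → isFilterWith (suc n) test ⟦ v ∷ʳ b ⟧)

filterCount-suc : ∀ n test → filterCount (suc n) test ≡ extending n true test + extending n false test
filterCount-suc n test = count-∷ʳ n (isFilterWith (suc n) test ∘ ⟦_⟧)

module _ (t : ℕ) where

  private
    n₃ n₄ n₅ n₆ : ℕ
    n₃ = 3 + double t
    n₄ = 4 + double t
    n₅ = 5 + double t
    n₆ = 6 + double t

  odd-absent : ∀ test P → P n₅ ≡ false →
               isFilterWith n₅ test P ≡ isFilterWith n₄ test P
  odd-absent test P absent = cong₂ (λ closed m → closed ∧ test m)
    (isClosed-suc-absent n₄ absent λ a _ g → ⊥-elim (true≢false g (nothing-below-odd t a)))
    (#minimal-suc-absent n₄ absent)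

  odd-present-without-prev : ∀ test P → P n₅ ≡ true → P n₄ ≡ false →
                             isFilterWith n₅ test P ≡ false
  odd-present-without-prev test P present prev = cong (_∧ test (#minimal n₅ P))
    (isClosed-false n₅ n₅ n₄ (s≤s z≤n) ≤-refl (s≤s z≤n) (n≤1+n _) (odd<pred t) present prev)

  odd-present-with-prev : ∀ test P → P n₅ ≡ true → P n₄ ≡ true →
                          isFilterWith n₅ test P ≡ isFilterWith n₃ (test ∘ suc) P
  odd-present-with-prev test P present prev = cong₂ (λ closed m → closed ∧ test m) closed≡ #minimal≡
    where
    only-prev-above : ∀ c → c ≤ n₄ → gen n₅ c ≡ true → P c ≡ true
    only-prev-above c c≤ g with above-odd t c g
    ... | inj₁ refl = prev
    ... | inj₂ refl = ⊥-elim (1+k+x≰x 1 n₄ c≤)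
    closed≡ : isClosed n₅ P ≡ isClosed n₃ P
    closed≡ = trans (isClosed-suc-present n₄ present only-prev-above)
                    (isClosed-suc-present n₃ prev λ c _ g → ⊥-elim (true≢false g (nothing-above-even t c)))
    not-above : ∀ a → a ≤ n₃ → gen n₅ a ≡ false
    not-above a a≤ = ¬true⇒false λ g → case (above-odd t a g)
      where
      case : a ≡ n₄ ⊎ a ≡ n₆ → ⊥
      case (inj₁ refl) = 1+k+x≰x 0 n₃ a≤
      case (inj₂ refl) = 1+k+x≰x 2 n₃ a≤
    unaffected : ∀ a → a ≤ n₃ → isMinimal n₅ P a ≡ isMinimal n₃ P a
    unaffected a a≤ = trans
      (isMinimal-suc-unaffected n₄ P a (cong (_∧ P n₅) (not-above a a≤)))
      (isMinimal-suc-unaffected n₃ P a (cong (_∧ P n₄) (nothing-above-even t a)))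
    prev-not-minimal : indicator (isMinimal n₅ P n₄) ≡ 0
    prev-not-minimal = cong indicator (trans (∧-not-∨ (P n₄) _ _)
      (trans (cong₂ (λ g p → isMinimal n₄ P n₄ ∧ not (g ∧ p)) (odd<pred t) present) (∧-zeroʳ _)))
    new-minimal : indicator (isMinimal n₅ P n₅) ≡ 1
    new-minimal = cong₂ (λ p any-below → indicator (p ∧ not any-below)) present
      (anyUpTo-false n₅ λ c → cong (_∧ P c) (nothing-below-odd t c))
    #minimal≡ : #minimal n₅ P ≡ suc (#minimal n₃ P)
    #minimal≡ = begin
      countUpTo n₃ (isMinimal n₅ P) + indicator (isMinimal n₅ P n₄)
        + indicator (isMinimal n₅ P n₅)
        ≡⟨ cong₂ _+_ (cong₂ _+_ (countUpTo-cong n₃ unaffected) prev-not-minimal) new-minimal ⟩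
      #minimal n₃ P + 0 + 1
        ≡⟨ +-comm _ 1 ⟩
      1 + (#minimal n₃ P + 0)
        ≡⟨ cong suc (+-identityʳ _) ⟩
      suc (#minimal n₃ P) ∎
      where open ≡-Reasoning

  even-absent-with-prev : ∀ test P → P n₆ ≡ false → P n₅ ≡ true →
                          isFilterWith n₆ test P ≡ false
  even-absent-with-prev test P absent prev = cong (_∧ test (#minimal n₆ P))
    (isClosed-false n₆ n₅ n₆ (s≤s z≤n) (n≤1+n _) (s≤s z≤n) ≤-refl (odd<suc t) prev absent)

  even-absent-without-prev : ∀ test P → P n₆ ≡ false → P n₅ ≡ false →
                             isFilterWith n₆ test P ≡ isFilterWith n₄ test P
  even-absent-without-prev test P absent prev = cong₂ (λ closed m → closed ∧ test m)
    (trans (isClosed-suc-absent n₅ absent only-prev-below)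
           (isClosed-suc-absent n₄ prev λ a _ g → ⊥-elim (true≢false g (nothing-below-odd t a))))
    (trans (#minimal-suc-absent n₅ absent) (#minimal-suc-absent n₄ prev))
    where
    only-prev-below : ∀ a → a ≤ n₅ → gen a n₆ ≡ true → P a ≡ false
    only-prev-below a a≤ g with below-even t a g
    ... | inj₁ refl = prev
    ... | inj₂ refl = ⊥-elim (1+k+x≰x 1 n₅ a≤)

  isClosed-even-present : ∀ {P} → P n₆ ≡ true → isClosed n₆ P ≡ isClosed n₅ P
  isClosed-even-present present =
    isClosed-suc-present n₅ present λ c _ g → ⊥-elim (true≢false g (nothing-above-even (suc t) c))

  even-present-with-prev : ∀ test P → P n₆ ≡ true → P n₅ ≡ true →
                           isFilterWith n₆ test P ≡ isFilterWith n₅ test P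
  even-present-with-prev test P present prev = cong₂ (λ closed m → closed ∧ test m)
    (isClosed-even-present present)
    (trans (#minimal-suc-maximal n₅ (nothing-above-even (suc t)))
           (trans (cong (_+_ (#minimal n₅ P)) new-not-minimal) (+-identityʳ _)))
    where
    new-not-minimal : indicator (isMinimal n₆ P n₆) ≡ 0
    new-not-minimal = cong₂ (λ p any-below → indicator (p ∧ not any-below)) present
      (anyUpTo-true⁺ n₆ n₅ (s≤s z≤n) (n≤1+n _) (∧-true⁺ (odd<suc t) prev))

  even-present-without-prev : ∀ test P → P n₆ ≡ true → P n₅ ≡ false →
                              isFilterWith n₆ test P ≡ isFilterWith n₅ (test ∘ suc) P
  even-present-without-prev test P present prev = cong₂ (λ closed m → closed ∧ test m)
    (isClosed-even-present present)
    (trans (#minimal-suc-maximal n₅ (nothing-above-even (suc t)))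
           (trans (cong (_+_ (#minimal n₅ P)) new-minimal) (+-comm _ 1)))
    where
    nothing-present-below : anyUpTo n₆ (λ c → gen c n₆ ∧ P c) ≡ false
    nothing-present-below = ¬true⇒false λ h →
      let a , _ , a≤ , g∧Pa = anyUpTo-true⁻ n₆ h in absent-below a a≤ (∧-true⁻ {gen a n₆} g∧Pa)
      where
      absent-below : ∀ a → a ≤ n₆ → gen a n₆ ≡ true × P a ≡ true → ⊥
      absent-below a a≤ (g , Pa) with below-even t a g
      ... | inj₁ refl = true≢false Pa prev
      ... | inj₂ refl = 1+k+x≰x 0 n₆ a≤
    new-minimal : indicator (isMinimal n₆ P n₆) ≡ 1
    new-minimal = cong₂ (λ p any-below → indicator (p ∧ not any-below)) present nothing-present-below

  extending-odd-false : ∀ test → extending n₄ false test ≡ filterCount n₄ test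
  extending-odd-false test = count-cong n₄ λ v →
    trans (odd-absent test ⟦ v ∷ʳ false ⟧ (⟦∷ʳ⟧-new v false)) (isFilterWith-∷ʳ n₄ test v false ≤-refl)

  extending-odd-true : ∀ test → extending n₄ true test ≡ filterCount n₃ (test ∘ suc)
  extending-odd-true test = begin
    extending n₄ true test
      ≡⟨ count-∷ʳ n₃ (λ v → isFilterWith n₅ test ⟦ v ∷ʳ true ⟧) ⟩
    count n₃ (λ u → isFilterWith n₅ test ⟦ u ∷ʳ true ∷ʳ true ⟧) +
    count n₃ (λ u → isFilterWith n₅ test ⟦ u ∷ʳ false ∷ʳ true ⟧)
      ≡⟨ cong₂ _+_ (count-cong n₃ with-prev) (trans (count-cong n₃ without-prev) (count-false n₃)) ⟩
    filterCount n₃ (test ∘ suc) + 0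
      ≡⟨ +-identityʳ _ ⟩
    filterCount n₃ (test ∘ suc) ∎
    where
    open ≡-Reasoning
    with-prev : ∀ u → isFilterWith n₅ test ⟦ u ∷ʳ true ∷ʳ true ⟧ ≡ isFilterWith n₃ (test ∘ suc) ⟦ u ⟧
    with-prev u = trans
      (odd-present-with-prev test ⟦ u ∷ʳ true ∷ʳ true ⟧ (⟦∷ʳ⟧-new (u ∷ʳ true) true) (⟦∷ʳ∷ʳ⟧-middle u true true))
      (isFilterWith-∷ʳ∷ʳ n₃ (test ∘ suc) u true true)
    without-prev : ∀ u → isFilterWith n₅ test ⟦ u ∷ʳ false ∷ʳ true ⟧ ≡ false
    without-prev u =
      odd-present-without-prev test ⟦ u ∷ʳ false ∷ʳ true ⟧ (⟦∷ʳ⟧-new (u ∷ʳ false) true) (⟦∷ʳ∷ʳ⟧-middle u false true)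

  extending-even-false : ∀ test → extending n₅ false test ≡ filterCount n₄ test
  extending-even-false test = trans (count-∷ʳ n₄ λ v → isFilterWith n₆ test ⟦ v ∷ʳ false ⟧)
    (cong₂ _+_ (trans (count-cong n₄ with-prev) (count-false n₄)) (count-cong n₄ without-prev))
    where
    with-prev : ∀ u → isFilterWith n₆ test ⟦ u ∷ʳ true ∷ʳ false ⟧ ≡ false
    with-prev u =
      even-absent-with-prev test ⟦ u ∷ʳ true ∷ʳ false ⟧ (⟦∷ʳ⟧-new (u ∷ʳ true) false) (⟦∷ʳ∷ʳ⟧-middle u true false)
    without-prev : ∀ u → isFilterWith n₆ test ⟦ u ∷ʳ false ∷ʳ false ⟧ ≡ isFilterWith n₄ test ⟦ u ⟧
    without-prev u = trans
      (even-absent-without-prev test ⟦ u ∷ʳ false ∷ʳ false ⟧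
        (⟦∷ʳ⟧-new (u ∷ʳ false) false) (⟦∷ʳ∷ʳ⟧-middle u false false))
      (isFilterWith-∷ʳ∷ʳ n₄ test u false false)

  extending-even-true : ∀ test →
                        extending n₅ true test ≡ extending n₄ true test + extending n₄ false (test ∘ suc)
  extending-even-true test = trans (count-∷ʳ n₄ λ v → isFilterWith n₆ test ⟦ v ∷ʳ true ⟧)
    (cong₂ _+_ (count-cong n₄ with-prev) (count-cong n₄ without-prev))
    where
    with-prev : ∀ u → isFilterWith n₆ test ⟦ u ∷ʳ true ∷ʳ true ⟧ ≡ isFilterWith n₅ test ⟦ u ∷ʳ true ⟧
    with-prev u = trans
      (even-present-with-prev test ⟦ u ∷ʳ true ∷ʳ true ⟧ (⟦∷ʳ⟧-new (u ∷ʳ true) true) (⟦∷ʳ∷ʳ⟧-middle u true true))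
      (isFilterWith-∷ʳ n₅ test (u ∷ʳ true) true ≤-refl)
    without-prev : ∀ u →
                   isFilterWith n₆ test ⟦ u ∷ʳ false ∷ʳ true ⟧ ≡ isFilterWith n₅ (test ∘ suc) ⟦ u ∷ʳ false ⟧
    without-prev u = trans
      (even-present-without-prev test ⟦ u ∷ʳ false ∷ʳ true ⟧
        (⟦∷ʳ⟧-new (u ∷ʳ false) true) (⟦∷ʳ∷ʳ⟧-middle u false true))
      (isFilterWith-∷ʳ n₅ (test ∘ suc) (u ∷ʳ false) true ≤-refl)

  filterCount-odd : ∀ test →
                    filterCount n₅ test ≡ filterCount n₄ test + filterCount n₃ (test ∘ suc)
  filterCount-odd test = begin
    filterCount n₅ test
      ≡⟨ filterCount-suc n₄ test ⟩
    extending n₄ true test + extending n₄ false test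
      ≡⟨ cong₂ _+_ (extending-odd-true test) (extending-odd-false test) ⟩
    filterCount n₃ (test ∘ suc) + filterCount n₄ test
      ≡⟨ +-comm (filterCount n₃ (test ∘ suc)) _ ⟩
    filterCount n₄ test + filterCount n₃ (test ∘ suc) ∎
    where open ≡-Reasoning

  filterCount-even : ∀ test →
                     filterCount n₆ test ≡ filterCount n₅ test + filterCount n₄ (test ∘ suc)
  filterCount-even test = begin
    filterCount n₆ test
      ≡⟨ filterCount-suc n₅ test ⟩
    extending n₅ true test + extending n₅ false test
      ≡⟨ cong₂ _+_ (extending-even-true test) (extending-even-false test) ⟩
    e + extending n₄ false (test ∘ suc) + filterCount n₄ test
      ≡⟨ cong (λ x → e + x + filterCount n₄ test) (extending-odd-false (test ∘ suc)) ⟩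
    e + filterCount n₄ (test ∘ suc) + filterCount n₄ test
      ≡⟨ xy∙z≈xz∙y e _ _ ⟩
    e + filterCount n₄ test + filterCount n₄ (test ∘ suc)
      ≡⟨ cong (_+ filterCount n₄ (test ∘ suc)) odd-step ⟨
    filterCount n₅ test + filterCount n₄ (test ∘ suc) ∎
    where
    open ≡-Reasoning
    e : ℕ
    e = extending n₄ true test
    odd-step : filterCount n₅ test ≡ e + filterCount n₄ test
    odd-step = trans (filterCount-suc n₄ test) (cong (_+_ e) (extending-odd-false test))

data Parity : ℕ → Set where
  even : ∀ t → Parity (double t)
  odd  : ∀ t → Parity (suc (double t))

parity : ∀ m → Parity m
parity zero = even zero
parity (suc m) with parity m
... | even t = odd t
... | odd t  = even (suc t)

filterCount-recurrence : ∀ m test →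
                         filterCount (5 + m) test ≡ filterCount (4 + m) test + filterCount (3 + m) (test ∘ suc)
filterCount-recurrence m test with parity m
... | even t = filterCount-odd t test
... | odd t  = filterCount-even t test

y·_ : Series → Series
(y· A) zero    k = + 0
(y· A) (suc n) k = A n k

x·_ : Series → Series
(x· A) n zero    = + 0
(x· A) n (suc k) = A n k

sumTo-zero : ∀ m {f : ℕ → ℤ} → (∀ i → f i ≡ + 0) → sumTo m f ≡ + 0
sumTo-zero zero    e = e 0
sumTo-zero (suc m) e = cong₂ _+ℤ_ (sumTo-zero m e) (e (suc m))

sumTo-suc : ∀ m (f : ℕ → ℤ) → sumTo (suc m) f ≡ f 0 +ℤ sumTo m (f ∘ suc)
sumTo-suc zero    f = refl
sumTo-suc (suc m) f = trans (cong (_+ℤ f (2 + m)) (sumTo-suc m f)) (ℤ.+-assoc (f 0) _ _)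

sumTo-head : ∀ m {f : ℕ → ℤ} → (∀ i → f (suc i) ≡ + 0) → sumTo m f ≡ f 0
sumTo-head zero    e = refl
sumTo-head (suc m) {f} e = trans (sumTo-suc m f) (trans (cong (f 0 +ℤ_) (sumTo-zero m e)) (ℤ.+-identityʳ (f 0)))

-- the i-th row of (den ⊛ A) n k, in which A is already shifted to A (n ∸ i)
row : Series → ℕ → ℕ → ℕ → ℤ
row A n k i = sumTo k (λ j → den i j *ℤ A n (k ∸ j))

row₀ : ∀ A n k → row A n k 0 ≡ A n k
row₀ A n k = trans (sumTo-head k λ _ → refl) (ℤ.*-identityˡ (A n k))

row₁ : ∀ A n k → row A n k 1 ≡ - A n k
row₁ A n k = trans (sumTo-head k λ _ → refl) (ℤ.-1*i≡-i (A n k))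

row₂ : ∀ A n k → row A n k 2 ≡ - (x· A) n k
row₂ A n zero    = refl
row₂ A n (suc k) =
  trans (sumTo-suc k _) (trans (ℤ.+-identityˡ _) (trans (sumTo-head k λ _ → refl) (ℤ.-1*i≡-i (A n k))))

row₃₊ : ∀ A n k i → row A n k (3 + i) ≡ + 0
row₃₊ A n k i = sumTo-zero k λ _ → refl

den⊛ : ∀ A n k → (den ⊛ A) n k ≡ A n k +ℤ (- (y· A) n k +ℤ - (y· y· x· A) n k)
den⊛ A zero          k = trans (row₀ A 0 k) (sym (ℤ.+-identityʳ (A 0 k)))
den⊛ A (suc zero)    k = cong₂ _+ℤ_ (row₀ A 1 k) (trans (row₁ A 0 k) (sym (ℤ.+-identityʳ (- A 0 k))))
den⊛ A (suc (suc m)) k = begin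
  sumTo (2 + m) (λ i → row A (2 + m ∸ i) k i)
    ≡⟨ sumTo-suc (suc m) _ ⟩
  row A (2 + m) k 0 +ℤ sumTo (suc m) (λ i → row A (1 + m ∸ i) k (suc i))
    ≡⟨ cong (row A (2 + m) k 0 +ℤ_) (sumTo-suc m _) ⟩
  row A (2 + m) k 0 +ℤ (row A (1 + m) k 1 +ℤ sumTo m (λ i → row A (m ∸ i) k (2 + i)))
    ≡⟨ cong₂ (λ r₀ r₁₊ → r₀ +ℤ r₁₊) (row₀ A (2 + m) k)
             (cong₂ _+ℤ_ (row₁ A (1 + m) k) (trans (sumTo-head m λ i → row₃₊ A (m ∸ suc i) k i) (row₂ A m k))) ⟩
  A (2 + m) k +ℤ (- A (1 + m) k +ℤ - (x· A) m k) ∎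
  where open ≡-Reasoning

x·Dgf≡filterCount : ∀ n k → (x· Dgf) n k ≡ + filterCount n (λ m → suc m ≡ᵇ k)
x·Dgf≡filterCount n zero    = cong +_ (sym (trans (count-cong n λ v → ∧-zeroʳ (isClosed n ⟦ v ⟧)) (count-false n)))
x·Dgf≡filterCount n (suc k) = cong +_ (d⁻≡filterCount n k)

+[a+b]-a-b≡0 : ∀ a b → + (a + b) +ℤ (- + a +ℤ - + b) ≡ + 0
+[a+b]-a-b≡0 a b = trans (cong₂ _+ℤ_ (ℤ.pos-+ a b) (sym (ℤ.neg-distrib-+ (+ a) (+ b)))) (ℤ.+-inverseʳ (+ a +ℤ + b))

Dgf-coefficient≡num : ∀ n k → Dgf n k +ℤ (- (y· Dgf) n k +ℤ - (y· y· x· Dgf) n k) ≡ num n k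
Dgf-coefficient≡num 0 0                   = refl
Dgf-coefficient≡num 0 (suc k)             = refl
Dgf-coefficient≡num 1 0                   = refl
Dgf-coefficient≡num 1 1                   = refl
Dgf-coefficient≡num 1 (suc (suc k))       = refl
Dgf-coefficient≡num 2 0                   = refl
Dgf-coefficient≡num 2 1                   = refl
Dgf-coefficient≡num 2 (suc (suc k))       = refl
Dgf-coefficient≡num 3 0                   = refl
Dgf-coefficient≡num 3 1                   = refl
Dgf-coefficient≡num 3 2                   = refl
Dgf-coefficient≡num 3 (suc (suc (suc k))) = refl
Dgf-coefficient≡num 4 0                   = refl
Dgf-coefficient≡num 4 1                   = refl
Dgf-coefficient≡num 4 2                   = refl
Dgf-coefficient≡num 4 (suc (suc (suc k))) = refl
Dgf-coefficient≡num (suc (suc (suc (suc (suc m))))) k = begin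
  + d⁻ (5 + m) k +ℤ (- + d⁻ (4 + m) k +ℤ - (x· Dgf) (3 + m) k)
    ≡⟨ cong₂ (λ a b → + a +ℤ b) (trans (d⁻≡filterCount (5 + m) k) (filterCount-recurrence m (_≡ᵇ k)))
             (cong₂ (λ b c → - + b +ℤ - c) (d⁻≡filterCount (4 + m) k) (x·Dgf≡filterCount (3 + m) k)) ⟩
  + (filterCount (4 + m) (_≡ᵇ k) + filterCount (3 + m) (λ c → suc c ≡ᵇ k))
    +ℤ (- + filterCount (4 + m) (_≡ᵇ k) +ℤ - + filterCount (3 + m) (λ c → suc c ≡ᵇ k))
    ≡⟨ +[a+b]-a-b≡0 (filterCount (4 + m) (_≡ᵇ k)) _ ⟩
  + 0 ∎
  where open ≡-Reasoning

theorem7 : (den ⊛ Dgf) ≋ num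
theorem7 n k = trans (den⊛ Dgf n k) (Dgf-coefficient≡num n k)
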